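{- Let $s,p,q,k\in\mathbb Z$ and let $(b_n)$ be the lens sequence generated by the symbol ${}^{s}(p,q)^{k}$. Then $(b_n)$ is primitive if and only if $$\gcd(p,q)=\gcd(p,k)=\gcd(s,q)=1.$$
   Context: The symbol ${}^{s}(p,q)^{k}$ defines the bilateral integer sequence $(f_n)_{n\in\mathbb Z}$ with $f_0=p$, $f_1=q$, $f_n=kf_{n-1}-f_{n-2}$ for $n$ even and $f_n=sf_{n-1}-f_{n-2}$ for $n$ odd (applied forwards and backwards), and the lens sequence it generates is $b_n=f_{n-1}f_n$; equivalently, the lens sequence with consecutive terms $(b_0,b_1,b_2)=((sp-q)p,\;pq,\;q(kq-p))$, extended by $b_n=(ks-2)b_{n-1}-b_{n-2}+\beta$ with $\beta=kq^2+sp^2-kspq$. An integer lens sequence is primitive if the gcd of three consecutive terms is $1$ (independent of position). -}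

module Defs where

open import Data.Nat as ℕ using (ℕ; zero; suc)
open import Data.Integer using (ℤ; +_; -[1+_]; _+_; _-_; _*_; 1ℤ)
open import Data.Integer.GCD using (gcd)
open import Relation.Binary.PropositionalEquality using (_≡_)

-- Recurrence coefficient at index n (for n ≥ 0 or its parity class):
-- k if n is even, s if n is odd.
coef : ℤ → ℤ → ℕ → ℤ
coef s k zero    = k
coef s k (suc n) = coef k s n

-- forward part: fwd s p q k n = f_n  (n ≥ 0)
-- f_{n+2} = c(n+2) f_{n+1} - f_n, and n+2 has the parity of n.
fwd : (s p q k : ℤ) → ℕ → ℤ
fwd s p q k zero          = p
fwd s p q k (suc zero)    = q
fwd s p q k (suc (suc n)) = coef s k n * fwd s p q k (suc n) - fwd s p q k n

-- backward part: bwd s p q k m = f_{-m}  (m ≥ 0)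
-- From f_j = c(j) f_{j-1} - f_{j-2} at j = -m:
-- f_{-m-2} = c(-m) f_{-m-1} - f_{-m}, and -m has the parity of m.
bwd : (s p q k : ℤ) → ℕ → ℤ
bwd s p q k zero          = p
bwd s p q k (suc zero)    = s * p - q
bwd s p q k (suc (suc m)) = coef s k m * bwd s p q k (suc m) - bwd s p q k m

symSeq : (s p q k : ℤ) → ℤ → ℤ
symSeq s p q k (+ n)      = fwd s p q k n
symSeq s p q k -[1+ m ]   = bwd s p q k (suc m)

lensSeq : (s p q k : ℤ) → ℤ → ℤ
lensSeq s p q k n = symSeq s p q k (n - 1ℤ) * symSeq s p q k n

Primitive : (ℤ → ℤ) → Set
Primitive b = ∀ n → gcd (gcd (b n) (b (n + 1ℤ))) (b (n + + 2)) ≡ 1ℤ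

{-# OPTIONS --safe #-}

-- The gcd of the window b_n, b_{n+1}, b_{n+2} only depends on the local symbol
-- ^v(x,y)^u with x = f_n, y = f_{n+1}, and the three coprimality conditions of
-- the theorem are preserved when the symbol is moved one step in either
-- direction, because each new entry is an old one minus a multiple of its
-- neighbour.  So everything reduces to the window (sp - q)p, pq, q(kq - p) of a
-- single symbol.
module Submission where

open import Defs
open import Data.Nat using (zero; suc)
import Data.Nat.Coprimality as ℕᶜ
import Data.Nat.Divisibility as ℕᵈ
import Data.Nat.Properties as ℕᵖ
open import Data.Integer using (ℤ; +_; -[1+_]; 1ℤ; _+_; _-_; _*_; ∣_∣)
open import Data.Integer.Properties using (abs-*; +-injective; neg-involutive)
open import Data.Integer.Coprimality using (Coprime; coprime-divisor)
  renaming (sym to coprime-sym)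
open import Data.Integer.Divisibility.Signed
open import Data.Integer.GCD using (gcd)
import Data.Integer.GCD as ℤ
open import Data.Integer.Tactic.RingSolver using (solve-∀)
open import Data.Product using (_×_; _,_)
open import Data.Product.Function.NonDependent.Propositional using (_×-⇔_)
open import Function.Bundles using (_⇔_; mk⇔; module Equivalence)
open import Function.Properties.Equivalence using (trans; sym)
open import Relation.Binary.PropositionalEquality using (_≡_; refl; cong; cong₂; subst)
  renaming (sym to ≡-sym; trans to ≡-trans)

∣m-n∣m⇒∣n : ∀ {i m n} → i ∣ m - n → i ∣ m → i ∣ n
∣m-n∣m⇒∣n {i} {m} {n} i∣m-n i∣m =
  subst (i ∣_) (neg-involutive n) (∣m⇒∣-m (∣m+n∣m⇒∣n i∣m-n i∣m))

i≡j-[j-i] : ∀ i j → i ≡ j - (j - i)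
i≡j-[j-i] = solve-∀

gcd≡1⇔coprime : ∀ x y → gcd x y ≡ 1ℤ ⇔ Coprime x y
gcd≡1⇔coprime x y = mk⇔ to from
  where
  to : gcd x y ≡ 1ℤ → Coprime x y
  to eq = ℕᶜ.gcd≡1⇒coprime (+-injective eq)
  from : Coprime x y → gcd x y ≡ 1ℤ
  from c = cong +_ (ℕᶜ.coprime⇒gcd≡1 c)

coprime-∣ʳ : ∀ x {y z} → Coprime x y → z ∣ y → Coprime x z
coprime-∣ʳ x c z∣y {d} (d∣x , d∣z) = c {d} (d∣x , ℕᵈ.∣-trans d∣z (∣⇒∣ᵤ z∣y))

coprime-*ʳ : ∀ x y z → Coprime x y → Coprime x z → Coprime x (y * z)
coprime-*ʳ x y z c₁ c₂ {d} (d∣x , d∣yz) =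
  c₂ (d∣x , ℕᶜ.coprime-divisor d⊥y (subst (d ℕᵈ.∣_) (abs-* y z) d∣yz))
  where
  d⊥y : ℕᶜ.Coprime d ∣ y ∣
  d⊥y {e} (e∣d , e∣y) = c₁ {e} (ℕᵈ.∣-trans e∣d d∣x , e∣y)

coprime-sub-multiple : ∀ x y {z} → Coprime x y → y ∣ z → Coprime (z - x) y
coprime-sub-multiple x y c y∣z {d} (d∣z-x , d∣y) =
  c {d} (∣⇒∣ᵤ (∣m-n∣m⇒∣n (∣ᵤ⇒∣ {+ d} d∣z-x) (∣-trans (∣ᵤ⇒∣ {+ d} d∣y) y∣z)) , d∣y)

Coprime₃ : ℤ → ℤ → ℤ → Set
Coprime₃ a b c = ∀ {d} → d ℕᵈ.∣ ∣ a ∣ → d ℕᵈ.∣ ∣ b ∣ → d ℕᵈ.∣ ∣ c ∣ → d ≡ 1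

gcd₃≡1⇔coprime₃ : ∀ a b c → gcd (gcd a b) c ≡ 1ℤ ⇔ Coprime₃ a b c
gcd₃≡1⇔coprime₃ a b c = mk⇔ to from
  where
  to : gcd (gcd a b) c ≡ 1ℤ → Coprime₃ a b c
  to eq {d} d∣a d∣b d∣c = ℕᵈ.∣1⇒≡1 (subst (d ℕᵈ.∣_) (+-injective eq)
    (ℤ.gcd-greatest {gcd a b} {c} {+ d} (ℤ.gcd-greatest {a} {b} {+ d} d∣a d∣b) d∣c))
  from : Coprime₃ a b c → gcd (gcd a b) c ≡ 1ℤ
  from c₃ = cong +_ (c₃ (ℕᵈ.∣-trans (ℤ.gcd[i,j]∣i (gcd a b) c) (ℤ.gcd[i,j]∣i a b))
                        (ℕᵈ.∣-trans (ℤ.gcd[i,j]∣i (gcd a b) c) (ℤ.gcd[i,j]∣j a b))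
                        (ℤ.gcd[i,j]∣j (gcd a b) c))

coprime₃-resp : ∀ {a a′ b b′ c c′} → a ≡ a′ → b ≡ b′ → c ≡ c′ →
                Coprime₃ a b c → Coprime₃ a′ b′ c′
coprime₃-resp refl refl refl c₃ = c₃

record CoprimeSymbol (s p q k : ℤ) : Set where
  constructor coprimeSymbol
  field
    p⊥q : Coprime p q
    p⊥k : Coprime p k
    s⊥q : Coprime s q

coprimeSymbol⇔gcd≡1 : ∀ s p q k →
  CoprimeSymbol s p q k ⇔ (gcd p q ≡ 1ℤ × gcd p k ≡ 1ℤ × gcd s q ≡ 1ℤ)
coprimeSymbol⇔gcd≡1 s p q k =
  trans fields⇔ (sym (gcd≡1⇔coprime p q ×-⇔ gcd≡1⇔coprime p k ×-⇔ gcd≡1⇔coprime s q))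
  where
  fields⇔ : CoprimeSymbol s p q k ⇔ (Coprime p q × Coprime p k × Coprime s q)
  fields⇔ = mk⇔ (λ (coprimeSymbol p⊥q p⊥k s⊥q) → p⊥q , p⊥k , s⊥q)
                (λ (p⊥q , p⊥k , s⊥q) → coprimeSymbol p⊥q p⊥k s⊥q)

coprimeSymbol-shiftʳ : ∀ {s p q k} → CoprimeSymbol s p q k → CoprimeSymbol k q (k * q - p) s
coprimeSymbol-shiftʳ {s} {p} {q} {k} (coprimeSymbol p⊥q p⊥k s⊥q) = coprimeSymbol
  (coprime-sym {k * q - p} {q} (coprime-sub-multiple p q p⊥q (∣n⇒∣m*n k ∣-refl)))
  (coprime-sym {s} {q} s⊥q)
  (coprime-sym {k * q - p} {k} (coprime-sub-multiple p k p⊥k (∣m⇒∣m*n q ∣-refl)))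

coprimeSymbol-shiftˡ : ∀ {s p q k} → CoprimeSymbol s p q k → CoprimeSymbol k (s * p - q) p s
coprimeSymbol-shiftˡ {s} {p} {q} {k} (coprimeSymbol p⊥q p⊥k s⊥q) = coprimeSymbol
  (coprime-sub-multiple q p (coprime-sym {p} {q} p⊥q) (∣n⇒∣m*n s ∣-refl))
  (coprime-sub-multiple q s (coprime-sym {s} {q} s⊥q) (∣m⇒∣m*n p ∣-refl))
  (coprime-sym {p} {k} p⊥k)

lensWindow-coprime₃⇔coprimeSymbol : ∀ s p q k →
  Coprime₃ ((s * p - q) * p) (p * q) (q * (k * q - p)) ⇔ CoprimeSymbol s p q k
lensWindow-coprime₃⇔coprimeSymbol s p q k = mk⇔ to from
  where
  to : Coprime₃ ((s * p - q) * p) (p * q) (q * (k * q - p)) → CoprimeSymbol s p q k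
  to c₃ = coprimeSymbol p⊥q p⊥k s⊥q
    where
    common : ∀ {d} → + d ∣ (s * p - q) * p → + d ∣ p * q → + d ∣ q * (k * q - p) → d ≡ 1
    common d∣a d∣b d∣c = c₃ (∣⇒∣ᵤ d∣a) (∣⇒∣ᵤ d∣b) (∣⇒∣ᵤ d∣c)
    p⊥q : Coprime p q
    p⊥q {d} (d∣p , d∣q) =
      common (∣n⇒∣m*n (s * p - q) dp) (∣m⇒∣m*n q dp) (∣m⇒∣m*n (k * q - p) dq)
      where dp = ∣ᵤ⇒∣ {+ d} {p} d∣p; dq = ∣ᵤ⇒∣ {+ d} {q} d∣q
    p⊥k : Coprime p k
    p⊥k {d} (d∣p , d∣k) =
      common (∣n⇒∣m*n (s * p - q) dp) (∣m⇒∣m*n q dp) (∣n⇒∣m*n q (∣m∣n⇒∣m-n (∣m⇒∣m*n q dk) dp))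
      where dp = ∣ᵤ⇒∣ {+ d} {p} d∣p; dk = ∣ᵤ⇒∣ {+ d} {k} d∣k
    s⊥q : Coprime s q
    s⊥q {d} (d∣s , d∣q) =
      common (∣m⇒∣m*n p (∣m∣n⇒∣m-n (∣m⇒∣m*n p ds) dq)) (∣n⇒∣m*n p dq) (∣m⇒∣m*n (k * q - p) dq)
      where ds = ∣ᵤ⇒∣ {+ d} {s} d∣s; dq = ∣ᵤ⇒∣ {+ d} {q} d∣q

  from : CoprimeSymbol s p q k → Coprime₃ ((s * p - q) * p) (p * q) (q * (k * q - p))
  from (coprimeSymbol p⊥q p⊥k s⊥q) {d} d∣a d∣b d∣c = q⊥d {d} (d∣q , ℕᵈ.∣-refl)
    where
    -- Adding the middle term to the outer ones gives p²s and q²k, which are prime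
    -- to q and to p respectively; so d is prime to p and q and divides pq.
    p[ps] : ∀ s p q → (s * p - q) * p + p * q ≡ p * (p * s)
    p[ps] = solve-∀
    q[qk] : ∀ k p q → q * (k * q - p) + p * q ≡ q * (q * k)
    q[qk] = solve-∀
    d∣p[ps] : + d ∣ p * (p * s)
    d∣p[ps] = subst (+ d ∣_) (p[ps] s p q)
      (∣m∣n⇒∣m+n (∣ᵤ⇒∣ {+ d} {(s * p - q) * p} d∣a) (∣ᵤ⇒∣ {+ d} {p * q} d∣b))
    d∣q[qk] : + d ∣ q * (q * k)
    d∣q[qk] = subst (+ d ∣_) (q[qk] k p q)
      (∣m∣n⇒∣m+n (∣ᵤ⇒∣ {+ d} {q * (k * q - p)} d∣c) (∣ᵤ⇒∣ {+ d} {p * q} d∣b))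
    q⊥p : Coprime q p
    q⊥p = coprime-sym {p} {q} p⊥q
    p⊥d : Coprime p (+ d)
    p⊥d = coprime-∣ʳ p (coprime-*ʳ p q (q * k) p⊥q (coprime-*ʳ p q k p⊥q p⊥k)) d∣q[qk]
    q⊥d : Coprime q (+ d)
    q⊥d = coprime-∣ʳ q
      (coprime-*ʳ q p (p * s) q⊥p (coprime-*ʳ q p s q⊥p (coprime-sym {s} {q} s⊥q))) d∣p[ps]
    d∣q : d ℕᵈ.∣ ∣ q ∣
    d∣q = coprime-divisor (+ d) p q (coprime-sym {p} {+ d} p⊥d) d∣b

record SymbolAt (F : ℤ → ℤ) (n s p q k : ℤ) : Set where
  constructor symbolAt
  field
    at-pred : F (n - 1ℤ) ≡ s * p - q
    at      : F n ≡ p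
    at-suc  : F (n + 1ℤ) ≡ q
    at-suc² : F (n + + 2) ≡ k * q - p

-- The three products are the lens terms b_n, b_{n+1}, b_{n+2} of F written out.
coprime₃-lensWindow : ∀ {F n s p q k} → SymbolAt F n s p q k → CoprimeSymbol s p q k →
  Coprime₃ (F (n - 1ℤ) * F n) (F (n + 1ℤ - 1ℤ) * F (n + 1ℤ)) (F (n + + 2 - 1ℤ) * F (n + + 2))
coprime₃-lensWindow {F} {n} {s} {p} {q} {k} (symbolAt e₋₁ e₀ e₁ e₂) σ =
  coprime₃-resp (≡-sym (cong₂ _*_ e₋₁ e₀))
                (≡-sym (cong₂ _*_ (≡-trans (cong F (n+1-1≡n n)) e₀) e₁))
                (≡-sym (cong₂ _*_ (≡-trans (cong F (n+2-1≡n+1 n)) e₁) e₂))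
                (Equivalence.from (lensWindow-coprime₃⇔coprimeSymbol s p q k) σ)
  where
  n+1-1≡n : ∀ n → n + 1ℤ - 1ℤ ≡ n
  n+1-1≡n = solve-∀
  n+2-1≡n+1 : ∀ n → n + + 2 - 1ℤ ≡ n + 1ℤ
  n+2-1≡n+1 = solve-∀

module _ (s p q k : ℤ) where
  private
    F = symSeq s p q k
    L = lensSeq s p q k
    f = fwd s p q k
    b = bwd s p q k
    c = coef s k

  fwd-coprimeSymbol : CoprimeSymbol s p q k →
                      ∀ i → CoprimeSymbol (c (suc i)) (f i) (f (suc i)) (c i)
  fwd-coprimeSymbol σ zero    = σ
  fwd-coprimeSymbol σ (suc i) = coprimeSymbol-shiftʳ (fwd-coprimeSymbol σ i)

  bwd-coprimeSymbol : CoprimeSymbol s p q k →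
                      ∀ m → CoprimeSymbol (c m) (b (suc m)) (b m) (c (suc m))
  bwd-coprimeSymbol σ zero    = coprimeSymbol-shiftˡ σ
  bwd-coprimeSymbol σ (suc m) = coprimeSymbol-shiftˡ (bwd-coprimeSymbol σ m)

  fwd-symbolAt : ∀ i → SymbolAt F (+ i) (c (suc i)) (f i) (f (suc i)) (c i)
  fwd-symbolAt i = symbolAt (at-pred i) refl (cong f (ℕᵖ.+-comm i 1)) (cong f (ℕᵖ.+-comm i 2))
    where
    at-pred : ∀ i → F (+ i - 1ℤ) ≡ c (suc i) * f i - f (suc i)
    at-pred zero    = refl
    at-pred (suc i) = i≡j-[j-i] (f i) (c i * f (suc i))

  bwd-symbolAt : ∀ m → SymbolAt F -[1+ m ] (c m) (b (suc m)) (b m) (c (suc m))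
  bwd-symbolAt m =
    symbolAt (cong (λ j → b (suc (suc j))) (ℕᵖ.+-identityʳ m)) refl (at-suc m) (at-suc² m)
    where
    at-suc : ∀ m → F (-[1+ m ] + 1ℤ) ≡ b m
    at-suc zero    = refl
    at-suc (suc m) = refl
    at-suc² : ∀ m → F (-[1+ m ] + + 2) ≡ c (suc m) * b m - b (suc m)
    at-suc² zero          = i≡j-[j-i] q (s * p)
    at-suc² (suc zero)    = i≡j-[j-i] p (k * b 1)
    at-suc² (suc (suc m)) = i≡j-[j-i] (b (suc m)) (c (suc m) * b (suc (suc m)))

  primitive⇔coprimeSymbol : Primitive L ⇔ CoprimeSymbol s p q k
  primitive⇔coprimeSymbol = mk⇔ to from
    where
    window : ∀ n → gcd (gcd (L n) (L (n + 1ℤ))) (L (n + + 2)) ≡ 1ℤ ⇔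
                   Coprime₃ (L n) (L (n + 1ℤ)) (L (n + + 2))
    window n = gcd₃≡1⇔coprime₃ (L n) (L (n + 1ℤ)) (L (n + + 2))
    to : Primitive L → CoprimeSymbol s p q k
    to P = Equivalence.to (lensWindow-coprime₃⇔coprimeSymbol s p q k)
                          (Equivalence.to (window (+ 0)) (P (+ 0)))
    from : CoprimeSymbol s p q k → Primitive L
    from σ (+ i)    = Equivalence.from (window (+ i))
      (coprime₃-lensWindow (fwd-symbolAt i) (fwd-coprimeSymbol σ i))
    from σ -[1+ m ] = Equivalence.from (window -[1+ m ])
      (coprime₃-lensWindow (bwd-symbolAt m) (bwd-coprimeSymbol σ m))

proposition5p9 : (s p q k : ℤ) →
    Primitive (lensSeq s p q k) ⇔
      (gcd p q ≡ 1ℤ × gcd p k ≡ 1ℤ × gcd s q ≡ 1ℤ)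
proposition5p9 s p q k = trans (primitive⇔coprimeSymbol s p q k) (coprimeSymbol⇔gcd≡1 s p q k)
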